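{- Let $\mathcal{S}=(C_1\cup C_2,\Sigma,\mathcal{P})$ be a system with $\mathcal{P}\subseteq\Sigma\times(\Sigma_1\cup\Sigma_2)$. Let $R$ be a deterministic finite automaton over $\Sigma$ (risk specification) and $A$ a deterministic finite automaton over $\Sigma$ (assumption), with complement $\overline{A}$. Let $\mathcal{P}_1\subseteq\Sigma\times\Sigma_1$ and $\mathcal{P}_2\subseteq\Sigma\times\Sigma_2$ be two non-conflicting sets of priorities, and let $\mathcal{S}_{1+}=(C_1\cup\{d_1\},\Sigma,(\mathcal{P}\cap\Sigma\times\Sigma_1)\cup\mathcal{P}_1)$ and $\mathcal{S}_{2+}=(C_2\cup\{d_2\},\Sigma,(\mathcal{P}\cap\Sigma\times\Sigma_2)\cup\mathcal{P}_2)$. If $\mathcal{L}(\mathcal{S}_{1+})\cap\mathcal{L}(R)\cap\mathcal{L}(A)=\emptyset$ and $\mathcal{L}(\mathcal{S}_{2+})\cap\mathcal{L}(\overline{A})=\emptyset$, then the system $\mathcal{S}_+=(C_1\cup C_2,\Sigma,\mathcal{P}\cup\mathcal{P}_1\cup\mathcal{P}_2)$ is B-safe with respect to $R$, i.e., $\mathcal{L}(\mathcal{S}_+)\cap\mathcal{L}(R)=\emptyset$.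
   Context: A system is a tuple $\mathcal{S}=(C,\Sigma,\mathcal{P})$ where $\Sigma$ is a finite set of interaction labels; $C$ is a finite set of components, each $C_i=(L_i,V_i,\Sigma_i',T_i,l_i^0,e_i^0)$ with $L_i$ a finite set of locations, $V_i$ a finite set of Boolean variables, $\Sigma_i'\subseteq\Sigma$ its alphabet, $T_i$ a set of transitions $(l,g,\sigma,f,l')$ with $l,l'\in L_i$, guard $g$ a Boolean formula over $V_i$, $\sigma\in\Sigma_i'$, and update $f$ mapping each $v\in V_i$ to a Boolean formula over $V_i$; $l_i^0$ is the initial location and $e_i^0$ the initial evaluation. $\mathcal{P}\subseteq\Sigma\times\Sigma$ is a priority relation. A configuration assigns each component a location and evaluation; the initial configuration $c^0$ uses the initial ones. $\sigma$ satisfies joint participation in configuration $c$ if every component whose alphabet contains $\sigma$ has a transition labelled $\sigma$ from its current location with guard true under its current evaluation; $\sigma$ is enabled if it satisfies joint participation and there is no $\bar\sigma$ satisfying joint participation with $(\sigma,\bar\sigma)\in\mathcal{P}$. If $\sigma$ is enabled in $c$, $c\xrightarrow{\sigma}c'$ when each component whose alphabet contains $\sigma$ takes such a transition $(l,g,\sigma,f,l')$ (new location $l'$, new evaluation $e'(v)=f(v)(e)$) and all other components are unchanged. The language $\mathcal{L}(\mathcal{S})$ is the set of words $\sigma_1\cdots\sigma_k\in\Sigma^*$ such that there are configurations $c^0\xrightarrow{\sigma_1}c_1\cdots\xrightarrow{\sigma_k}c_k$. For a DFA $R$, $\mathcal{L}(R)$ is its language; $\mathcal{S}$ is B-safe w.r.t.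 $R$ if $\mathcal{L}(\mathcal{S})\cap\mathcal{L}(R)=\emptyset$. $\mathcal{L}(\overline{A})=\Sigma^*\setminus\mathcal{L}(A)$. Decomposition: $C_1$ and $C_2$ are sets of components, and $\Sigma$ is partitioned into $\Sigma_{12}$ (interactions appearing in components of both $C_1$ and $C_2$), $\Sigma_1$ (interactions appearing only in components of $C_1$) and $\Sigma_2$ (interactions appearing only in components of $C_2$). For $i=1,2$, $d_i$ is a component with a single location, no variables, and, for each $\sigma\in\Sigma_{3-i}$, a self-loop transition labelled $\sigma$ with guard true (simulating stuttering). $\mathcal{P}_1,\mathcal{P}_2$ non-conflicting means there is no conflict between them, i.e., $\mathcal{P}\cup\mathcal{P}_1\cup\mathcal{P}_2$ is still a legal priority relation (transitive and irreflexive). -}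

module Defs where

open import Data.Nat using (ℕ)
open import Data.Fin using (Fin; zero)
open import Data.Bool using (Bool; true; false; not; _∧_)
open import Data.List using (List; []; _∷_; _++_; map; filterᵇ; allFin; foldl)
open import Data.Bool.ListAction using (any)
open import Data.List.Relation.Unary.Any using (Any)
open import Data.List.Relation.Unary.All using (All; []; _∷_)
open import Data.Fin.Subset using (Subset; _∈_; _∉_)
open import Data.Fin.Subset.Properties using (_∈?_)
open import Data.Vec using (tabulate)
open import Data.Product using (Σ; _×_; _,_; proj₁; proj₂)
open import Data.Sum using (_⊎_)
open import Data.Empty using (⊥)
open import Data.Unit using (⊤)
open import Relation.Nullary using (¬_; does)
open import Relation.Binary.PropositionalEquality using (_≡_)

-- Interaction labels: Σ = Fin n.
-- Boolean formulas over V are represented semantically, as Boolean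
-- functions of the evaluation (every such function is expressible by a
-- formula since V is finite).

Eval : ℕ → Set
Eval nV = Fin nV → Bool

Guard : ℕ → Set
Guard nV = Eval nV → Bool

Update : ℕ → Set
Update nV = Fin nV → Eval nV → Bool

record Transition (n nL nV : ℕ) : Set where
  constructor mkTr
  field
    src   : Fin nL
    guard : Guard nV
    label : Fin n
    upd   : Update nV
    tgt   : Fin nL

record Component (n : ℕ) : Set where
  field
    nL    : ℕ
    nV    : ℕ
    alph  : Subset n
    trans : List (Transition n nL nV)
    l0    : Fin nL
    e0    : Eval nV
open Component public
open Transition public

-- priority relation P ⊆ Σ × Σ ; (σ , σ̄) ∈ P means σ̄ has priority over σ
Prio : ℕ → Set₁
Prio n = Fin n → Fin n → Set

record System (n : ℕ) : Set₁ where
  constructor mkSys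
  field
    comps : List (Component n)
    prio  : Prio n
open System public

LegalPrio : ∀ {n} → Prio n → Set
LegalPrio {n} P =
  (∀ (a b c : Fin n) → P a b → P b c → P a c) × (∀ (a : Fin n) → ¬ P a a)

_∪ᴾ_ : ∀ {n} → Prio n → Prio n → Prio n
(P ∪ᴾ Q) a b = P a b ⊎ Q a b

State : ∀ {n} → Component n → Set
State c = Fin (nL c) × Eval (nV c)

Config : ∀ {n} → List (Component n) → Set
Config cs = All State cs

initConfig : ∀ {n} (cs : List (Component n)) → Config cs
initConfig [] = []
initConfig (c ∷ cs) = (l0 c , e0 c) ∷ initConfig cs

Fireable : ∀ {n} (c : Component n) → State c → Fin n → Transition n (nL c) (nV c) → Set
Fireable c s σ t = src t ≡ proj₁ s × label t ≡ σ × guard t (proj₂ s) ≡ true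

LocalJP : ∀ {n} (c : Component n) → State c → Fin n → Set
LocalJP c s σ = σ ∈ alph c → Any (Fireable c s σ) (trans c)

JointParticipation : ∀ {n} {cs : List (Component n)} → Fin n → Config cs → Set
JointParticipation σ [] = ⊤
JointParticipation {cs = c ∷ _} σ (s ∷ ss) = LocalJP c s σ × JointParticipation σ ss

Enabled : ∀ {n} → Prio n → {cs : List (Component n)} → Fin n → Config cs → Set
Enabled {n} P σ cfg =
  JointParticipation σ cfg × (∀ (σ̄ : Fin n) → P σ σ̄ → ¬ JointParticipation σ̄ cfg)

LocalStep : ∀ {n} (c : Component n) → Fin n → State c → State c → Set
LocalStep c σ s s' =
  (σ ∈ alph c × Any (λ t → Fireable c s σ t × s' ≡ (tgt t , λ v → upd t v (proj₂ s))) (trans c))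
  ⊎ (σ ∉ alph c × s' ≡ s)

Moves : ∀ {n} {cs : List (Component n)} → Fin n → Config cs → Config cs → Set
Moves σ [] [] = ⊤
Moves {cs = c ∷ _} σ (s ∷ ss) (s' ∷ ss') = LocalStep c σ s s' × Moves σ ss ss'

Step : ∀ {n} (S : System n) → Fin n → Config (comps S) → Config (comps S) → Set
Step S σ cfg cfg' = Enabled (prio S) σ cfg × Moves σ cfg cfg'

data Run {n} (S : System n) : Config (comps S) → List (Fin n) → Config (comps S) → Set where
  done : ∀ {c} → Run S c [] c
  step : ∀ {c c' c'' σ w} → Step S σ c c' → Run S c' w c'' → Run S c (σ ∷ w) c''

InLang : ∀ {n} → System n → List (Fin n) → Set
InLang S w = Σ (Config (comps S)) (λ c → Run S (initConfig (comps S)) w c)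

record DFA (n : ℕ) : Set where
  field
    nQ     : ℕ
    q0     : Fin nQ
    δ      : Fin nQ → Fin n → Fin nQ
    accept : Fin nQ → Bool
open DFA public

Accepts : ∀ {n} → DFA n → List (Fin n) → Set
Accepts A w = accept A (foldl (δ A) (q0 A) w) ≡ true

complement : ∀ {n} → DFA n → DFA n
complement A = record { nQ = nQ A ; q0 = q0 A ; δ = δ A ; accept = λ q → not (accept A q) }

occurs : ∀ {n} → List (Component n) → Fin n → Bool
occurs cs σ = any (λ c → does (σ ∈? alph c)) cs

inΣ12 inΣ1 inΣ2 : ∀ {n} → List (Component n) → List (Component n) → Fin n → Bool
inΣ12 C₁ C₂ σ = occurs C₁ σ ∧ occurs C₂ σ
inΣ1 C₁ C₂ σ = occurs C₁ σ ∧ not (occurs C₂ σ)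
inΣ2 C₁ C₂ σ = not (occurs C₁ σ) ∧ occurs C₂ σ

stutter : ∀ {n} → (Fin n → Bool) → Component n
stutter {n} p = record
  { nL = 1 ; nV = 0
  ; alph = tabulate p
  ; trans = map (λ σ → mkTr zero (λ _ → true) σ (λ ()) zero) (filterᵇ p (allFin n))
  ; l0 = zero ; e0 = λ () }

d₁ d₂ : ∀ {n} → List (Component n) → List (Component n) → Component n
d₁ C₁ C₂ = stutter (inΣ2 C₁ C₂)
d₂ C₁ C₂ = stutter (inΣ1 C₁ C₂)

restrictTo : ∀ {n} → Prio n → (Fin n → Bool) → Prio n
restrictTo P p a b = P a b × p b ≡ true

module Submission where

-- Every behaviour of the composed system
-- S₊ = (C₁ ∪ C₂, P ∪ P₁ ∪ P₂) is a behaviour of both S₁₊ and S₂₊.  So a word w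
-- of S₊ accepted by R is, if A accepts w, a word of S₁₊ in L(R) ∩ L(A), and
-- otherwise a word of S₂₊ in L(Ā); both contradict the hypotheses.
--
-- Both inclusions L(S₊) ⊆ L(S_{i+}) are instances of one projection lemma:
-- split the components Cs into a kept block Xs and a dropped block Ys (a
-- Decomposition) and replace Ys by a stuttering component.  This is a forward
-- simulation since a stuttering component never blocks and can always move,
-- joint participation in Cs is joint participation in both blocks, and each
-- priority of the smaller system is one of the larger system whose dominating
-- interaction does not occur in Ys (so participation in Xs already blocks).

open import Defs
open import Data.Nat using (ℕ)
open import Data.Fin using (Fin; zero)
open import Data.Bool using (Bool; true; false; not; _∧_; T?)
open import Data.Bool.Properties using (T-≡)
open import Data.List using (List; []; _∷_; _++_; foldl)
open import Data.List.Relation.Unary.Any.Properties using (map⁺)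
open import Data.List.Relation.Unary.All using ([]; _∷_)
open import Data.List.Relation.Unary.All.Properties using (++⁺; ++⁻)
open import Data.List.Membership.Propositional using (find; lose)
open import Data.List.Membership.Propositional.Properties using (∈-filter⁺; ∈-allFin)
open import Data.Fin.Subset.Properties using (_∈?_)
open import Data.Vec.Properties using (lookup∘tabulate; []=⇒lookup)
open import Data.Product using (Σ; _×_; _,_; proj₁; proj₂; swap)
open import Data.Sum using (_⊎_; inj₁; inj₂)
open import Data.Empty using (⊥)
open import Data.Unit using (tt)
open import Function using (_∘_; _⇔_; mk⇔; Equivalence)
open import Relation.Nullary using (¬_; yes; no; contradiction)
open import Relation.Binary.PropositionalEquality
  using (_≡_; refl; sym; cong)
  renaming (trans to ≡-trans)

module _ {n : ℕ} where

  init-++ : ∀ (xs ys : List (Component n)) →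
            initConfig (xs ++ ys) ≡ ++⁺ (initConfig xs) (initConfig ys)
  init-++ []       ys = refl
  init-++ (x ∷ xs) ys = cong (_ ∷_) (init-++ xs ys)

  jp-++⁻ : ∀ xs {ys : List (Component n)} σ (c : Config (xs ++ ys)) →
           JointParticipation σ c ⇔
           (JointParticipation σ (proj₁ (++⁻ xs c)) × JointParticipation σ (proj₂ (++⁻ xs c)))
  jp-++⁻ []       σ c       = mk⇔ (λ j → tt , j) proj₂
  jp-++⁻ (x ∷ xs) σ (s ∷ c) =
    mk⇔ (λ (j , js) → let jl , jr = to js in (j , jl) , jr)
        (λ ((j , jl) , jr) → j , from (jl , jr))
    where open Equivalence (jp-++⁻ xs σ c)

  jp-++⁺ : ∀ {xs ys : List (Component n)} σ (a : Config xs) (b : Config ys) →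
           JointParticipation σ (++⁺ a b) ⇔ (JointParticipation σ a × JointParticipation σ b)
  jp-++⁺ σ []      b = mk⇔ (λ j → tt , j) proj₂
  jp-++⁺ σ (s ∷ a) b =
    mk⇔ (λ (j , js) → let ja , jb = to js in (j , ja) , jb)
        (λ ((j , ja) , jb) → j , from (ja , jb))
    where open Equivalence (jp-++⁺ σ a b)

  moves-++⁻ : ∀ xs {ys : List (Component n)} σ (c c' : Config (xs ++ ys)) → Moves σ c c' →
              Moves σ (proj₁ (++⁻ xs c)) (proj₁ (++⁻ xs c')) ×
              Moves σ (proj₂ (++⁻ xs c)) (proj₂ (++⁻ xs c'))
  moves-++⁻ []       σ c       c'        m        = tt , m
  moves-++⁻ (x ∷ xs) σ (s ∷ c) (s' ∷ c') (m , ms) =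
    let ml , mr = moves-++⁻ xs σ c c' ms in (m , ml) , mr

  moves-++⁺ : ∀ {xs ys : List (Component n)} σ (a a' : Config xs) (b b' : Config ys) →
              Moves σ a a' → Moves σ b b' → Moves σ (++⁺ a b) (++⁺ a' b')
  moves-++⁺ σ []      []        b b' _        mb = mb
  moves-++⁺ σ (s ∷ a) (s' ∷ a') b b' (m , ma) mb = m , moves-++⁺ σ a a' b b' ma mb

  jp-absent : ∀ (cs : List (Component n)) σ → occurs cs σ ≡ false →
              (c : Config cs) → JointParticipation σ c
  jp-absent []       σ _  []      = tt
  jp-absent (x ∷ cs) σ eq (s ∷ c) with σ ∈? alph x
  ... | no σ∉ = (λ σ∈ → contradiction σ∈ σ∉) , jp-absent cs σ eq c

  record Decomposition (Cs Xs Ys : List (Component n)) : Set where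
    field
      split       : Config Cs → Config Xs × Config Ys
      split-init  : split (initConfig Cs) ≡ (initConfig Xs , initConfig Ys)
      split-jp    : ∀ σ c → JointParticipation σ c ⇔
                    (JointParticipation σ (proj₁ (split c)) × JointParticipation σ (proj₂ (split c)))
      split-moves : ∀ σ c c' → Moves σ c c' → Moves σ (proj₁ (split c)) (proj₁ (split c'))

  split-init-++ : ∀ (xs ys : List (Component n)) →
                  ++⁻ xs (initConfig (xs ++ ys)) ≡ (initConfig xs , initConfig ys)
  split-init-++ []       ys = refl
  split-init-++ (x ∷ xs) ys rewrite split-init-++ xs ys = refl

  keepLeft : ∀ (xs ys : List (Component n)) → Decomposition (xs ++ ys) xs ys
  keepLeft xs ys = record
    { split       = ++⁻ xs
    ; split-init  = split-init-++ xs ys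
    ; split-jp    = jp-++⁻ xs
    ; split-moves = λ σ c c' m → proj₁ (moves-++⁻ xs σ c c' m) }

  keepRight : ∀ (xs ys : List (Component n)) → Decomposition (xs ++ ys) ys xs
  keepRight xs ys = record
    { split       = λ c → swap (++⁻ xs c)
    ; split-init  = cong swap (split-init-++ xs ys)
    ; split-jp    = λ σ c → let open Equivalence (jp-++⁻ xs σ c) in
                    mk⇔ (λ j → swap (to j)) (λ j → from (swap j))
    ; split-moves = λ σ c c' m → proj₂ (moves-++⁻ xs σ c c' m) }

  local-move : ∀ (c : Component n) s σ → LocalJP c s σ → Σ (State c) (LocalStep c σ s)
  local-move c s σ jp with σ ∈? alph c
  ... | no σ∉ = s , inj₂ (σ∉ , refl)
  ... | yes σ∈ with find (jp σ∈)
  ...   | t , t∈ , fireable =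
    (tgt t , λ v → upd t v (proj₂ s)) , inj₁ (σ∈ , lose t∈ (fireable , refl))

  -- A stuttering component never blocks: in its unique location it has a
  -- true-guarded self-loop for every interaction of its alphabet.
  stutter-jp : ∀ (p : Fin n → Bool) s σ → LocalJP (stutter p) s σ
  stutter-jp p (zero , e) σ σ∈ =
    map⁺ (lose (∈-filter⁺ (T? ∘ p) (∈-allFin σ) (Equivalence.from T-≡ pσ))
               (refl , refl , refl))
    where
      pσ : p σ ≡ true
      pσ = ≡-trans (sym (lookup∘tabulate p σ)) ([]=⇒lookup σ∈)

  simulation : ∀ {S T : System n} (_~_ : Config (comps S) → Config (comps T) → Set) →
    initConfig (comps S) ~ initConfig (comps T) →
    (∀ σ c c' t → c ~ t → Step S σ c c' → Σ (Config (comps T)) λ t' → Step T σ t t' × c' ~ t') →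
    ∀ w → InLang S w → InLang T w
  simulation {S} {T} _~_ init~ step~ w (_ , run) = go run init~
    where
      go : ∀ {c w c''} → Run S c w c'' → ∀ {t} → c ~ t → Σ _ (Run T t w)
      go done             _   = _ , done
      go (step st run) c~t with step~ _ _ _ _ c~t st
      ... | t' , st' , c'~t' = let t'' , run' = go run c'~t' in t'' , step st' run'

  project : ∀ {Cs Xs Ys} (D : Decomposition Cs Xs Ys) (p : Fin n → Bool) {Q Q' : Prio n} →
    (∀ σ σ̄ → Q' σ σ̄ → Q σ σ̄ × occurs Ys σ̄ ≡ false) →
    ∀ w → InLang (mkSys Cs Q) w → InLang (mkSys (Xs ++ stutter p ∷ []) Q') w
  project {Cs} {Xs} {Ys} D p {Q} {Q'} prio =
    simulation _~_ (stutterState , init~) step~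
    where
      open Decomposition D

      d : Component n
      d = stutter p

      _~_ : Config Cs → Config (Xs ++ d ∷ []) → Set
      c ~ t = Σ (State d) λ ds → t ≡ ++⁺ (proj₁ (split c)) (ds ∷ [])

      stutterState : State d
      stutterState = l0 d , e0 d

      init~ : initConfig (Xs ++ d ∷ []) ≡ ++⁺ (proj₁ (split (initConfig Cs))) (stutterState ∷ [])
      init~ rewrite split-init = init-++ Xs (d ∷ [])

      lift-jp : ∀ c σ̄ → occurs Ys σ̄ ≡ false →
                JointParticipation σ̄ (proj₁ (split c)) → JointParticipation σ̄ c
      lift-jp c σ̄ absent j = Equivalence.from (split-jp σ̄ c) (j , jp-absent Ys σ̄ absent _)

      -- a step of the source is matched by the same step of its Xs-block
      -- together with a stutter move
      step~ : ∀ σ c c' t → c ~ t → Step (mkSys Cs Q) σ c c' →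
              Σ _ λ t' → Step (mkSys (Xs ++ d ∷ []) Q') σ t t' × c' ~ t'
      step~ σ c c' _ (ds , refl) ((jp , maximal) , mv) =
        ++⁺ (proj₁ (split c')) (ds' ∷ []) , ((jp-target , maximal-target) , moves-target) , ds' , refl
        where
          a : Config Xs
          a = proj₁ (split c)

          stutter-move : Σ (State d) (LocalStep d σ ds)
          stutter-move = local-move d ds σ (stutter-jp p ds σ)

          ds' : State d
          ds' = proj₁ stutter-move

          jp-target : JointParticipation σ (++⁺ a (ds ∷ []))
          jp-target = Equivalence.from (jp-++⁺ σ a (ds ∷ []))
            (proj₁ (Equivalence.to (split-jp σ c) jp) , stutter-jp p ds σ , tt)

          maximal-target : ∀ σ̄ → Q' σ σ̄ → ¬ JointParticipation σ̄ (++⁺ a (ds ∷ []))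
          maximal-target σ̄ q j̄ = maximal σ̄ (proj₁ (prio σ σ̄ q))
            (lift-jp c σ̄ (proj₂ (prio σ σ̄ q)) (proj₁ (Equivalence.to (jp-++⁺ σ̄ a (ds ∷ [])) j̄)))

          moves-target : Moves σ (++⁺ a (ds ∷ [])) (++⁺ (proj₁ (split c')) (ds' ∷ []))
          moves-target = moves-++⁺ σ a (proj₁ (split c')) (ds ∷ []) (ds' ∷ [])
            (split-moves σ c c' mv) (proj₂ stutter-move , tt)

∧-not-true : ∀ x y → x ∧ not y ≡ true → y ≡ false
∧-not-true true false _ = refl

not-∧-true : ∀ x y → not x ∧ y ≡ true → x ≡ false
not-∧-true false _ _ = refl

module _ {n : ℕ} (C₁ C₂ : List (Component n)) (P P₁ P₂ : Prio n) where

  -- The priorities of S₁₊ are priorities of S₊ dominated by Σ₁-interactions,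
  -- which do not occur in C₂.
  priorities₁ : (∀ a b → P₁ a b → inΣ1 C₁ C₂ b ≡ true) →
    ∀ σ σ̄ → (restrictTo P (inΣ1 C₁ C₂) ∪ᴾ P₁) σ σ̄ →
    ((P ∪ᴾ P₁) ∪ᴾ P₂) σ σ̄ × occurs C₂ σ̄ ≡ false
  priorities₁ _  σ σ̄ (inj₁ (q , σ̄∈Σ₁)) = inj₁ (inj₁ q) , ∧-not-true (occurs C₁ σ̄) _ σ̄∈Σ₁
  priorities₁ h₁ σ σ̄ (inj₂ q)          = inj₁ (inj₂ q) , ∧-not-true (occurs C₁ σ̄) _ (h₁ σ σ̄ q)

  -- Symmetrically for S₂₊, whose priorities are dominated by Σ₂-interactions.
  priorities₂ : (∀ a b → P₂ a b → inΣ2 C₁ C₂ b ≡ true) →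
    ∀ σ σ̄ → (restrictTo P (inΣ2 C₁ C₂) ∪ᴾ P₂) σ σ̄ →
    ((P ∪ᴾ P₁) ∪ᴾ P₂) σ σ̄ × occurs C₁ σ̄ ≡ false
  priorities₂ _  σ σ̄ (inj₁ (q , σ̄∈Σ₂)) = inj₁ (inj₁ q) , not-∧-true _ (occurs C₂ σ̄) σ̄∈Σ₂
  priorities₂ h₂ σ σ̄ (inj₂ q)          = inj₂ q , not-∧-true _ (occurs C₂ σ̄) (h₂ σ σ̄ q)

-- Decide whether A accepts w and project the run of S₊ onto S₁₊ or S₂₊.
theorem3 : ∀ {n : ℕ} (C₁ C₂ : List (Component n)) (P P₁ P₂ : Prio n) (R A : DFA n) →
    LegalPrio P →
    (∀ a b → P a b → inΣ1 C₁ C₂ b ≡ true ⊎ inΣ2 C₁ C₂ b ≡ true) →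
    (∀ a b → P₁ a b → inΣ1 C₁ C₂ b ≡ true) →
    (∀ a b → P₂ a b → inΣ2 C₁ C₂ b ≡ true) →
    LegalPrio ((P ∪ᴾ P₁) ∪ᴾ P₂) →
    (∀ w → InLang (mkSys (C₁ ++ (d₁ C₁ C₂ ∷ [])) (restrictTo P (inΣ1 C₁ C₂) ∪ᴾ P₁)) w →
      Accepts R w → Accepts A w → ⊥) →
    (∀ w → InLang (mkSys (C₂ ++ (d₂ C₁ C₂ ∷ [])) (restrictTo P (inΣ2 C₁ C₂) ∪ᴾ P₂)) w →
      Accepts (complement A) w → ⊥) →
    ∀ w → InLang (mkSys (C₁ ++ C₂) ((P ∪ᴾ P₁) ∪ᴾ P₂)) w → Accepts R w → ⊥
theorem3 C₁ C₂ P P₁ P₂ R A _ _ h₁ h₂ _ safe₁ safe₂ w w∈S₊ accR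
  with accept A (foldl (δ A) (q0 A) w) in accA
... | true  = safe₁ w (project (keepLeft C₁ C₂) _ (priorities₁ C₁ C₂ P P₁ P₂ h₁) w w∈S₊) accR accA
... | false = safe₂ w (project (keepRight C₁ C₂) _ (priorities₂ C₁ C₂ P P₁ P₂ h₂) w w∈S₊) (cong not accA)
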